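{- Let $a$ be a weak composition. There exists a unique standard key tableau $T_a\in\mathrm{SKT}(a)$ with $\mathrm{des}(T_a)=a$. Moreover, for every $T\in\mathrm{SKT}(a)$ with $\mathrm{des}(T)\ne\varnothing$, we have $\mathrm{des}(T)\ge a$.
   Context: A weak composition is a sequence $a=(a_1,a_2,\ldots)$ of nonnegative integers with finitely many nonzero terms; $b\ge a$ means $b_1+\cdots+b_j\ge a_1+\cdots+a_j$ for all $j$. The key diagram of $a$ is the set of cells $(r,c)$ (row $r$ counted from the bottom, column $c$) with $1\le c\le a_r$. With $n=\sum_r a_r$, a standard key tableau of shape $a$ is a bijective filling of the key diagram of $a$ with $\{1,\ldots,n\}$ such that entries decrease from left to right along each row, and whenever an entry $i$ lies above an entry $k$ in the same column with $i<k$, there is an entry $j$ to the right of $k$ in the row of $k$ with $i<j$; $\mathrm{SKT}(a)$ is the set of these. For $T\in\mathrm{SKT}(a)$, $i\in\{1,\ldots,n-1\}$ is a descent of $T$ if $i+1$ lies in a column weakly to the right of the column of $i$. Cut the word $n\,(n-1)\cdots 2\,1$ between $i+1$ and $i$ exactly when $i$ is a descent, obtaining consecutive segments $\tau^{(k)},\ldots,\tau^{(1)}$ from left to right. Let $t_i$ be the least row index of a cell of $T$ containing an entry of $\tau^{(i)}$; set $\hat t_k=t_k$ and $\hat t_i=\min(t_i,\hat t_{i+1}-1)$ for $i<k$. If $\hat t_1\le 0$ then $\mathrm{des}(T)=\varnothing$ ($T$ is virtual); otherwise $\mathrm{des}(T)$ is the weak composition with $\hat t_i$-th part $|\tau^{(i)}|$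 for $i=1,\ldots,k$ and all other parts $0$. -}

module Defs where

open import Data.Nat using (ℕ; zero; suc; _+_; _∸_; _≤_; _<_; _≤ᵇ_; _≡ᵇ_)
open import Data.Nat as ℕ using ()
open import Data.Integer as ℤ using (ℤ; +_)
open import Data.List using (List; []; _∷_; length; map; concat; upTo)
open import Data.Nat.ListAction using (sum)
open import Data.Integer using (_≟_)
open import Relation.Nullary.Decidable using (⌊_⌋)
open import Data.List.Relation.Binary.Permutation.Propositional using (_↭_)
open import Data.Maybe using (Maybe; just; nothing)
open import Data.Product using (Σ; _×_; _,_; ∃-syntax)
open import Data.Bool using (Bool; true; false; if_then_else_)
open import Relation.Binary.PropositionalEquality using (_≡_)

-- A weak composition a = (a_1, a_2, ...) is given by the list
-- [a_1, ..., a_ℓ] of its first ℓ parts (all later parts are 0).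
-- `part a r` is a_r for r ≥ 1 (and 0 for r = 0, which is not a row).

part : List ℕ → ℕ → ℕ
part a       zero          = 0
part []      (suc r)       = 0
part (x ∷ a) (suc zero)    = x
part (x ∷ a) (suc (suc r)) = part a (suc r)

-- Weak compositions as functions on row indices r ≥ 1 (index 0 ignored).
WComp : Set
WComp = ℕ → ℕ

psum : WComp → ℕ → ℕ
psum f zero    = 0
psum f (suc j) = psum f j + f (suc j)

_⊵_ : WComp → WComp → Set
b ⊵ a = ∀ j → psum a j ≤ psum b j

_≈wc_ : WComp → WComp → Set
b ≈wc a = ∀ r → 1 ≤ r → b r ≡ a r

-- Fillings of key diagrams.
-- A filling T is a list of rows, T = [row 1, row 2, ...] (row 1 is the
-- bottom row), each row listed from column 1 to the right.

Filling : Set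
Filling = List (List ℕ)

nth : List ℕ → ℕ → Maybe ℕ
nth xs       zero          = nothing
nth []       (suc c)       = nothing
nth (x ∷ xs) (suc zero)    = just x
nth (x ∷ xs) (suc (suc c)) = nth xs (suc c)

rowOf : Filling → ℕ → List ℕ
rowOf T       zero          = []
rowOf []      (suc r)       = []
rowOf (x ∷ T) (suc zero)    = x
rowOf (x ∷ T) (suc (suc r)) = rowOf T (suc r)

cell : Filling → ℕ → ℕ → Maybe ℕ
cell T r c = nth (rowOf T r) c

n-of : List ℕ → ℕ
n-of a = sum a

record SKT (a : List ℕ) (T : Filling) : Set where
  field
    shape      : map length T ≡ a
    bijective  : concat T ↭ map suc (upTo (n-of a))
    rowDecr    : ∀ r c x y → cell T r c ≡ just x → cell T r (suc c) ≡ just y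
                 → y < x
    colCond    : ∀ r r′ c i k → r < r′ → cell T r′ c ≡ just i → cell T r c ≡ just k
                 → i < k → ∃[ c′ ] ∃[ j ] (c < c′ × cell T r c′ ≡ just j × i < j)

colIn : ℕ → List ℕ → ℕ → Maybe ℕ
colIn c []       x = nothing
colIn c (y ∷ ys) x = if y ≡ᵇ x then just c else colIn (suc c) ys x

-- position (row , column) of the entry x, searching from row `r`;
-- (0 , 0) if absent (never happens for standard key tableaux)
posFrom : ℕ → Filling → ℕ → ℕ × ℕ
posFrom r []       x = 0 , 0
posFrom r (ρ ∷ T) x with colIn 1 ρ x
... | just c  = r , c
... | nothing = posFrom (suc r) T x

rowPos : Filling → ℕ → ℕ
rowPos T x with posFrom 1 T x
... | r , c = r

colPos : Filling → ℕ → ℕ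
colPos T x with posFrom 1 T x
... | r , c = c

isDescent : Filling → ℕ → Bool
isDescent T i = colPos T i ≤ᵇ colPos T (suc i)

-- Segments τ^(1), ..., τ^(k) of the word n (n-1) ... 1 (τ^(1) contains 1),
-- listed as [τ^(1), ..., τ^(k)].
-- `segsFrom T i m cur` : `cur` is the current segment containing i,
-- m more values (i+1, ..., i+m) remain to be placed.
segsFrom : Filling → ℕ → ℕ → List ℕ → List (List ℕ)
segsFrom T i zero    cur = cur ∷ []
segsFrom T i (suc m) cur =
  if isDescent T i
  then cur ∷ segsFrom T (suc i) m (suc i ∷ [])
  else segsFrom T (suc i) m (suc i ∷ cur)

segments : Filling → ℕ → List (List ℕ)
segments T zero    = []
segments T (suc m) = segsFrom T 1 m (1 ∷ [])

minRow : Filling → List ℕ → ℕ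
minRow T []       = 0
minRow T (x ∷ []) = rowPos T x
minRow T (x ∷ y ∷ xs) = ℕ._⊓_ (rowPos T x) (minRow T (y ∷ xs))

hats : List ℕ → List ℤ
hats []       = []
hats (t ∷ ts) with hats ts
... | []      = (+ t) ∷ []
... | (h ∷ hs) = ℤ._⊓_ (+ t) (h ℤ.- ℤ.+ 1) ∷ h ∷ hs

compOf : List ℤ → List (List ℕ) → WComp
compOf (h ∷ hs) (τ ∷ τs) r =
  (if ⌊ h ≟ + r ⌋ then length τ else 0) + compOf hs τs r
compOf _ _ r = 0

-- des(T) : `nothing` encodes ∅ (T virtual); n = number of entries of T
des : Filling → Maybe WComp
des T with hats (map (minRow T) (segments T (length (concat T))))
... | []     = just (λ _ → 0)
... | h ∷ hs = if h ℤ.≤ᵇ ℤ.0ℤ then nothing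
               else just (compOf (h ∷ hs) (segments T (length (concat T))))

DesIs : Filling → List ℕ → Set
DesIs T a = ∃[ d ] (des T ≡ just d × d ≈wc part a)

-- Write S_j = a_1 + ⋯ + a_j. des(T) assigns each segment τ⁽ⁱ⁾ to the row t̂ᵢ; these rows increase
-- strictly and lie weakly below every entry of their segment. So each of the (at least S_j)
-- entries lying in rows ≤ j belongs to a segment assigned to a row ≤ j, and these segments have
-- total size equal to the j-th partial sum of des(T): this is des(T) ⊵ a. If des(T) = a, every
-- inequality in this chain is an equality, so each segment lies entirely in its row. Since the
-- segments are consecutive intervals of values, taken from the smallest values up, the entries in
-- rows ≤ j are then exactly 1, …, S_j, which forces row r to read S_r, S_r − 1, …, S_{r−1} + 1:
-- this is T_a. Conversely, the descents of T_a are exactly the ends of its nonempty rows, so its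
-- segments are those rows and des(T_a) = a.

module Submission where

open import Defs
open import Data.Bool using (true; false; if_then_else_)
open import Data.Bool.Properties using (T-≡)
open import Data.Empty using (⊥)
open import Data.Integer as ℤ using (ℤ; +≤+)
import Data.Integer.Properties as ℤ
open import Data.List using (List; []; _∷_; length; map; concat; applyUpTo; upTo; filter; _++_; _∷ʳ_)
open import Data.List.Membership.Propositional using (_∈_)
open import Data.List.Membership.Propositional.Properties using (∈-++⁺ˡ; ∈-++⁺ʳ; ∈-++⁻)
open import Data.List.Properties
  using (length-map; length-upTo; length-++; filter-++; length-filter; filter-all; filter-none;
         filter-complete; map-applyUpTo; ++-identityʳ)
open import Data.List.Relation.Binary.Permutation.Propositional
  using (_↭_; ↭-refl; ↭-sym; ↭-trans; ↭-reflexive; ↭-prep; module PermutationReasoning)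
open import Data.List.Relation.Binary.Permutation.Propositional.Properties
  using (↭-length; ∈-resp-↭; shift; ++⁺; filter-↭)
open import Data.List.Relation.Unary.All as All using (All; []; _∷_)
open import Data.List.Relation.Unary.All.Properties using (all-filter)
open import Data.List.Relation.Unary.Any using (here; there)
open import Data.List.Relation.Unary.Linked as Linked using (Linked; []; [-]; _∷_)
open import Data.List.Relation.Unary.Linked.Properties using (Linked⇒All)
open import Data.Maybe using (just; nothing)
open import Data.Nat
  using (ℕ; zero; suc; _+_; _∸_; _≤_; _≰_; _<_; _>_; z≤n; s≤s; s≤s⁻¹; _≤?_; _≡ᵇ_; _≤ᵇ_; _⊓_)
open import Data.Nat.ListAction using (sum)
open import Data.Nat.Properties
open import Algebra.Properties.CommutativeSemigroup +-commutativeSemigroup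
  using () renaming (interchange to +-interchange)
open import Data.Product using (_×_; _,_; proj₁; proj₂; ∃-syntax)
open import Data.Sum using (inj₁; inj₂)
open import Data.Unit using (⊤; tt)
open import Function using (_∘_)
open import Function.Bundles using (_⇔_; mk⇔; Equivalence)
open import Relation.Binary.PropositionalEquality
open import Relation.Nullary using (yes; no; contradiction)
open import Relation.Nullary.Decidable using (⌊_⌋; dec-true; dec-false; ⌊⌋-map′)
open import Relation.Unary using (Pred; Decidable; ∁)

-- Blocks of consecutive numbers

ascBlock : ℕ → ℕ → List ℕ
ascBlock lo zero    = []
ascBlock lo (suc L) = suc lo ∷ ascBlock (suc lo) L

descBlock : ℕ → ℕ → List ℕ
descBlock lo zero    = []
descBlock lo (suc L) = suc (lo + L) ∷ descBlock lo L

length-descBlock : ∀ lo L → length (descBlock lo L) ≡ L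
length-descBlock lo zero    = refl
length-descBlock lo (suc L) = cong suc (length-descBlock lo L)

applyUpTo-ascBlock : ∀ {f : ℕ → ℕ} lo L → (∀ i → f i ≡ suc (lo + i)) →
                     applyUpTo f L ≡ ascBlock lo L
applyUpTo-ascBlock lo zero    f≗ = refl
applyUpTo-ascBlock lo (suc L) f≗ = cong₂ _∷_ (trans (f≗ 0) (cong suc (+-identityʳ lo)))
  (applyUpTo-ascBlock (suc lo) L (λ i → trans (f≗ (suc i)) (cong suc (+-suc lo i))))

map-suc-upTo : ∀ n → map suc (upTo n) ≡ ascBlock 0 n
map-suc-upTo n = trans (map-applyUpTo (λ i → i) suc n) (applyUpTo-ascBlock 0 n (λ i → refl))

ascBlock-+ : ∀ lo m n → ascBlock lo (m + n) ≡ ascBlock lo m ++ ascBlock (lo + m) n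
ascBlock-+ lo zero    n = cong (λ l → ascBlock l n) (sym (+-identityʳ lo))
ascBlock-+ lo (suc m) n = cong (suc lo ∷_)
  (trans (ascBlock-+ (suc lo) m n) (cong (λ l → ascBlock (suc lo) m ++ ascBlock l n) (sym (+-suc lo m))))

ascBlock-suc : ∀ lo L → ascBlock lo (suc L) ≡ ascBlock lo L ∷ʳ suc (lo + L)
ascBlock-suc lo L = begin
  ascBlock lo (suc L)               ≡⟨ cong (ascBlock lo) (+-comm 1 L) ⟩
  ascBlock lo (L + 1)               ≡⟨ ascBlock-+ lo L 1 ⟩
  ascBlock lo L ∷ʳ suc (lo + L)     ∎
  where open ≡-Reasoning

descBlock↭ascBlock : ∀ lo L → descBlock lo L ↭ ascBlock lo L
descBlock↭ascBlock lo zero    = ↭-refl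
descBlock↭ascBlock lo (suc L) = begin
  suc (lo + L) ∷ descBlock lo L        ↭⟨ ↭-prep _ (descBlock↭ascBlock lo L) ⟩
  suc (lo + L) ∷ ascBlock lo L         ↭⟨ ↭-reflexive (cong (suc (lo + L) ∷_) (sym (++-identityʳ _))) ⟩
  suc (lo + L) ∷ ascBlock lo L ++ []   ↭⟨ ↭-sym (shift _ (ascBlock lo L) []) ⟩
  ascBlock lo L ∷ʳ suc (lo + L)        ≡⟨ sym (ascBlock-suc lo L) ⟩
  ascBlock lo (suc L)                  ∎
  where open PermutationReasoning

∈-ascBlock⁻ : ∀ {x} lo L → x ∈ ascBlock lo L → lo < x × x ≤ lo + L
∈-ascBlock⁻ lo (suc L) (here refl) = ≤-refl , ≤-trans (s≤s (m≤m+n lo L)) (≤-reflexive (sym (+-suc lo L)))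
∈-ascBlock⁻ lo (suc L) (there x∈) with ∈-ascBlock⁻ (suc lo) L x∈
... | lo<x , x≤ = <⇒≤ lo<x , ≤-trans x≤ (≤-reflexive (sym (+-suc lo L)))

∈-ascBlock⁺ : ∀ {x} lo L → lo < x → x ≤ lo + L → x ∈ ascBlock lo L
∈-ascBlock⁺ lo zero    lo<x x≤ = contradiction (≤-trans x≤ (≤-reflexive (+-identityʳ lo))) (<⇒≱ lo<x)
∈-ascBlock⁺ lo (suc L) lo<x x≤ with m≤n⇒m<n∨m≡n lo<x
... | inj₂ refl = here refl
... | inj₁ lo+1<x = there (∈-ascBlock⁺ (suc lo) L lo+1<x (≤-trans x≤ (≤-reflexive (+-suc lo L))))

∈-descBlock⁻ : ∀ {x} lo L → x ∈ descBlock lo L → lo < x × x ≤ lo + L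
∈-descBlock⁻ lo L x∈ = ∈-ascBlock⁻ lo L (∈-resp-↭ (descBlock↭ascBlock lo L) x∈)

Decreasing : List ℕ → Set
Decreasing = Linked _>_

descBlock-decreasing : ∀ lo L → Decreasing (descBlock lo L)
descBlock-decreasing lo zero          = []
descBlock-decreasing lo (suc zero)    = [-]
descBlock-decreasing lo (suc (suc L)) = s≤s (+-monoʳ-< lo ≤-refl) ∷ descBlock-decreasing lo (suc L)

decreasing-head> : ∀ {x ys} → Decreasing (x ∷ ys) → All (_< x) ys
decreasing-head> [-]       = []
decreasing-head> (x>y ∷ d) = Linked⇒All (λ p q → <-trans q p) x>y d

decreasing-head≥ : ∀ {lo x ys} → Decreasing (x ∷ ys) → All (lo <_) (x ∷ ys) → lo + length (x ∷ ys) ≤ x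
decreasing-head≥ {lo} {x} [-] (lo<x ∷ []) = ≤-trans (≤-reflexive (+-comm lo 1)) lo<x
decreasing-head≥ {lo} {x} {y ∷ ys} (x>y ∷ d) (_ ∷ lo<ys) =
  ≤-trans (≤-reflexive (+-suc lo (length (y ∷ ys)))) (≤-trans (s≤s (decreasing-head≥ d lo<ys)) x>y)

decreasing⇒descBlock : ∀ lo xs → Decreasing xs → All (λ y → lo < y × y ≤ lo + length xs) xs →
                       xs ≡ descBlock lo (length xs)
decreasing⇒descBlock lo []       d bounds = refl
decreasing⇒descBlock lo (x ∷ xs) d in-range@((_ , x≤) ∷ bounds) =
  cong₂ _∷_ x≡top (decreasing⇒descBlock lo xs (Linked.tail d) (All.zipWith tail-bounds (bounds , decreasing-head> d)))
  where
    x≡top : x ≡ suc (lo + length xs)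
    x≡top = ≤-antisym (≤-trans x≤ (≤-reflexive (+-suc lo _)))
                      (≤-trans (≤-reflexive (sym (+-suc lo _))) (decreasing-head≥ d (All.map proj₁ in-range)))
    tail-bounds : ∀ {y} → (lo < y × y ≤ lo + length (x ∷ xs)) × y < x → lo < y × y ≤ lo + length xs
    tail-bounds ((lo<y , _) , y<x) = lo<y , s≤s⁻¹ (subst (_ <_) x≡top y<x)

nth⇒decreasing : ∀ xs → (∀ c x y → nth xs c ≡ just x → nth xs (suc c) ≡ just y → y < x) → Decreasing xs
nth⇒decreasing []           _      = []
nth⇒decreasing (x ∷ [])     _      = [-]
nth⇒decreasing (x ∷ y ∷ xs) nth-gt = nth-gt 1 x y refl refl ∷ nth⇒decreasing (y ∷ xs) λ where
  (suc c) → nth-gt (suc (suc c))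

decreasing⇒nth : ∀ xs → Decreasing xs → ∀ c x y → nth xs c ≡ just x → nth xs (suc c) ≡ just y → y < x
decreasing⇒nth (x ∷ y ∷ xs) (x>y ∷ _) (suc zero)    _ _ refl refl = x>y
decreasing⇒nth (x ∷ y ∷ xs) (_ ∷ d)   (suc (suc c)) _ _ x≡ y≡     =
  decreasing⇒nth (y ∷ xs) d (suc c) _ _ x≡ y≡

module _ {a p} {A : Set a} {P : Pred A p} (P? : Decidable P) where

  count : List A → ℕ
  count xs = length (filter P? xs)

  count-↭ : ∀ {xs ys} → xs ↭ ys → count xs ≡ count ys
  count-↭ xs↭ys = ↭-length (filter-↭ P? xs↭ys)

  count-concat : ∀ xss → count (concat xss) ≡ sum (map count xss)
  count-concat []         = refl
  count-concat (xs ∷ xss) = begin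
    length (filter P? (xs ++ concat xss))          ≡⟨ cong length (filter-++ P? xs (concat xss)) ⟩
    length (filter P? xs ++ filter P? (concat xss)) ≡⟨ length-++ (filter P? xs) ⟩
    count xs + count (concat xss)                   ≡⟨ cong (count xs +_) (count-concat xss) ⟩
    count xs + sum (map count xss)                  ∎
    where open ≡-Reasoning

  count≤length : ∀ xs → count xs ≤ length xs
  count≤length = length-filter P?

  count-all : ∀ {xs} → All P xs → count xs ≡ length xs
  count-all Pxs = cong length (filter-all P? Pxs)

  count-none : ∀ {xs} → All (∁ P) xs → count xs ≡ 0
  count-none ¬Pxs = cong length (filter-none P? ¬Pxs)

  count-complete : ∀ xs → length xs ≤ count xs → All P xs
  count-complete xs len≤ =
    subst (All P) (filter-complete P? (≤-antisym (count≤length xs) len≤)) (all-filter P? xs)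

  count-zero : ∀ xs → count xs ≡ 0 → All (∁ P) xs
  count-zero []       _  = []
  count-zero (x ∷ xs) c with P? x
  ... | yes _  = contradiction c λ ()
  ... | no ¬px = ¬px ∷ count-zero xs c

psum-cong : ∀ f g j → (∀ r → 1 ≤ r → r ≤ j → f r ≡ g r) → psum f j ≡ psum g j
psum-cong f g zero    f≗g = refl
psum-cong f g (suc j) f≗g =
  cong₂ _+_ (psum-cong f g j (λ r 1≤r r≤j → f≗g r 1≤r (m≤n⇒m≤1+n r≤j)))
            (f≗g (suc j) (s≤s z≤n) ≤-refl)

psum-+ : ∀ f g j → psum (λ r → f r + g r) j ≡ psum f j + psum g j
psum-+ f g zero    = refl
psum-+ f g (suc j) = trans (cong (_+ (f (suc j) + g (suc j))) (psum-+ f g j))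
  (+-interchange (psum f j) (psum g j) (f (suc j)) (g (suc j)))

psum-shift : ∀ f j → psum f (suc j) ≡ f 1 + psum (λ r → f (suc r)) j
psum-shift f zero    = +-comm 0 (f 1)
psum-shift f (suc j) = trans (cong (_+ f (suc (suc j))) (psum-shift f j)) (+-assoc (f 1) _ _)

psum-zero : ∀ f j → (∀ r → f r ≡ 0) → psum f j ≡ 0
psum-zero f zero    f≗0 = refl
psum-zero f (suc j) f≗0 = cong₂ _+_ (psum-zero f j f≗0) (f≗0 (suc j))

psum-mono : ∀ f {i j} → i ≤ j → psum f i ≤ psum f j
psum-mono f {j = zero}  z≤n  = ≤-refl
psum-mono f {j = suc j} i≤j with m≤n⇒m<n∨m≡n i≤j
... | inj₂ refl       = ≤-refl
... | inj₁ (s≤s i≤j′) = ≤-trans (psum-mono f i≤j′) (m≤m+n (psum f j) (f (suc j)))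

psum-part-∷ : ∀ x a j → psum (part (x ∷ a)) (suc j) ≡ x + psum (part a) j
psum-part-∷ x a j = trans (psum-shift (part (x ∷ a)) j)
  (cong (x +_) (psum-cong _ _ j (λ { (suc r) _ _ → refl })))

psum-part-length : ∀ a → psum (part a) (length a) ≡ sum a
psum-part-length []      = refl
psum-part-length (x ∷ a) = trans (psum-part-∷ x a (length a)) (cong (x +_) (psum-part-length a))

psum-part≤sum : ∀ a j → psum (part a) j ≤ sum a
psum-part≤sum a       zero    = z≤n
psum-part≤sum []      (suc j) = ≤-reflexive (psum-zero (part []) (suc j) (λ { zero → refl ; (suc r) → refl }))
psum-part≤sum (x ∷ a) (suc j) = ≤-trans (≤-reflexive (psum-part-∷ x a j)) (+-monoʳ-≤ x (psum-part≤sum a j))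

part-beyond : ∀ a r → length a < r → part a r ≡ 0
part-beyond []      zero          _         = refl
part-beyond []      (suc r)       _         = refl
part-beyond (x ∷ a) (suc (suc r)) (s≤s len<) = part-beyond a (suc r) len<

part-map-length : ∀ T r → part (map length T) r ≡ length (rowOf T r)
part-map-length T       zero          = refl
part-map-length []      (suc r)       = refl
part-map-length (ρ ∷ T) (suc zero)    = refl
part-map-length (ρ ∷ T) (suc (suc r)) = part-map-length T (suc r)

rowSum : (List ℕ → ℕ) → Filling → ℕ → ℕ
rowSum g T = psum (λ r → g (rowOf T r))

rowSum≤sum : ∀ g T j → g [] ≡ 0 → rowSum g T j ≤ sum (map g T)
rowSum≤sum g []      j       g[]≡0 = ≤-reflexive (psum-zero _ j (λ { zero → g[]≡0 ; (suc r) → g[]≡0 }))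
rowSum≤sum g (ρ ∷ T) zero    g[]≡0 = z≤n
rowSum≤sum g (ρ ∷ T) (suc j) g[]≡0 = begin
  rowSum g (ρ ∷ T) (suc j)
    ≡⟨ psum-shift _ j ⟩
  g ρ + psum (λ r → g (rowOf (ρ ∷ T) (suc r))) j
    ≡⟨ cong (g ρ +_) (psum-cong _ _ j (λ { (suc r) _ _ → refl })) ⟩
  g ρ + rowSum g T j
    ≤⟨ +-monoʳ-≤ (g ρ) (rowSum≤sum g T j g[]≡0) ⟩
  sum (map g (ρ ∷ T)) ∎
  where open ≤-Reasoning

≡ᵇ-refl : ∀ x → (x ≡ᵇ x) ≡ true
≡ᵇ-refl x = Equivalence.to T-≡ (≡⇒≡ᵇ x x refl)

colIn-∈ : ∀ {x} c ρ → x ∈ ρ → ∃[ c′ ] colIn c ρ x ≡ just c′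
colIn-∈ {x} c (y ∷ ρ) (here refl) rewrite ≡ᵇ-refl x = c , refl
colIn-∈ {x} c (y ∷ ρ) (there x∈ρ) with y ≡ᵇ x
... | true  = c , refl
... | false = colIn-∈ (suc c) ρ x∈ρ

colIn-∉ : ∀ {x} c ρ → All (_≢ x) ρ → colIn c ρ x ≡ nothing
colIn-∉     c []      []          = refl
colIn-∉ {x} c (y ∷ ρ) (y≢x ∷ ρ≢x) with y ≡ᵇ x in y≡ᵇx
... | true  = contradiction (≡ᵇ⇒≡ y x (Equivalence.from T-≡ y≡ᵇx)) y≢x
... | false = colIn-∉ (suc c) ρ ρ≢x

colIn-≥ : ∀ {x c′} c ρ → colIn c ρ x ≡ just c′ → c ≤ c′
colIn-≥ {x} c (y ∷ ρ) found with y ≡ᵇ x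
colIn-≥     c (y ∷ ρ) refl  | true  = ≤-refl
colIn-≥     c (y ∷ ρ) found | false = <⇒≤ (colIn-≥ (suc c) ρ found)

rowPos-posFrom : ∀ T x → rowPos T x ≡ proj₁ (posFrom 1 T x)
rowPos-posFrom T x with posFrom 1 T x
... | r , c = refl

colPos-posFrom : ∀ T x → colPos T x ≡ proj₂ (posFrom 1 T x)
colPos-posFrom T x with posFrom 1 T x
... | r , c = refl

posFrom-row≤ : ∀ {x} T s r → x ∈ rowOf T (suc r) → proj₁ (posFrom s T x) ≤ s + r
posFrom-row≤ {x} (ρ ∷ T) s r x∈ with colIn 1 ρ x in notFound
... | just c  = m≤m+n s r
posFrom-row≤ (ρ ∷ T) s zero    x∈ | nothing with () ← trans (sym notFound) (proj₂ (colIn-∈ 1 ρ x∈))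
posFrom-row≤ (ρ ∷ T) s (suc r) x∈ | nothing =
  ≤-trans (posFrom-row≤ T (suc s) r x∈) (≤-reflexive (sym (+-suc s r)))

rowPos≤ : ∀ {x} T r → x ∈ rowOf T (suc r) → rowPos T x ≤ suc r
rowPos≤ T r x∈ = ≤-trans (≤-reflexive (rowPos-posFrom T _)) (posFrom-row≤ T 1 r x∈)

posFrom-first : ∀ {x c} T s r → (∀ r′ → r′ < r → All (_≢ x) (rowOf T (suc r′))) →
                colIn 1 (rowOf T (suc r)) x ≡ just c → posFrom s T x ≡ (s + r , c)
posFrom-first     (ρ ∷ T) s zero    earlier found rewrite found | +-identityʳ s = refl
posFrom-first {c = c} (ρ ∷ T) s (suc r) earlier found rewrite colIn-∉ 1 ρ (earlier 0 (s≤s z≤n)) =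
  trans (posFrom-first T (suc s) r (λ r′ r′<r → earlier (suc r′) (s≤s r′<r)) found)
        (cong (_, c) (sym (+-suc s r)))

posFrom-col≥1 : ∀ {x} T s → x ∈ concat T → 1 ≤ proj₂ (posFrom s T x)
posFrom-col≥1 {x} (ρ ∷ T) s x∈ with colIn 1 ρ x in found
... | just c  = colIn-≥ 1 ρ found
... | nothing with ∈-++⁻ ρ x∈
...   | inj₁ x∈ρ with () ← trans (sym found) (proj₂ (colIn-∈ 1 ρ x∈ρ))
...   | inj₂ x∈T = posFrom-col≥1 T (suc s) x∈T

colPos≥1 : ∀ {x} T → x ∈ concat T → 1 ≤ colPos T x
colPos≥1 T x∈ = ≤-trans (posFrom-col≥1 T 1 x∈) (≤-reflexive (sym (colPos-posFrom T _)))

-- Segments and their placement into rows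

Consecutive : ℕ → List (List ℕ) → Set
Consecutive lo []       = ⊤
Consecutive lo (τ ∷ τs) = τ ≡ descBlock lo (length τ) × Consecutive (lo + length τ) τs

concat-consecutive : ∀ lo τs → Consecutive lo τs → concat τs ↭ ascBlock lo (sum (map length τs))
concat-consecutive lo []       _             = ↭-refl
concat-consecutive lo (τ ∷ τs) (τ≡ , τs-cons) = begin
  τ ++ concat τs                                   ↭⟨ ++⁺ τ↭ (concat-consecutive (lo + L) τs τs-cons) ⟩
  ascBlock lo L ++ ascBlock (lo + L) (sum (map length τs)) ≡⟨ sym (ascBlock-+ lo L _) ⟩
  ascBlock lo (L + sum (map length τs))            ∎
  where
    open PermutationReasoning
    L : ℕ
    L = length τ
    τ↭ : τ ↭ ascBlock lo L
    τ↭ = ↭-trans (↭-reflexive τ≡) (descBlock↭ascBlock lo L)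

segsFrom-consecutive : ∀ T i m lo cur → cur ≡ descBlock lo (length cur) → i ≡ lo + length cur →
                       Consecutive lo (segsFrom T i m cur)
segsFrom-consecutive T i zero    lo cur cur≡ i≡ = cur≡ , tt
segsFrom-consecutive T i (suc m) lo cur cur≡ i≡ with isDescent T i
... | true  = cur≡ , segsFrom-consecutive T (suc i) m (lo + length cur) (suc i ∷ [])
                       (cong (λ k → suc k ∷ []) (trans i≡ (sym (+-identityʳ _))))
                       (trans (cong suc i≡) (+-comm 1 _))
... | false = segsFrom-consecutive T (suc i) m lo (suc i ∷ cur) (cong₂ _∷_ (cong suc i≡) cur≡)
                       (trans (cong suc i≡) (sym (+-suc lo _)))

segsFrom-size : ∀ T i m cur → sum (map length (segsFrom T i m cur)) ≡ length cur + m
segsFrom-size T i zero    cur = refl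
segsFrom-size T i (suc m) cur with isDescent T i
... | true  = cong (length cur +_) (segsFrom-size T (suc i) m (suc i ∷ []))
... | false = trans (segsFrom-size T (suc i) m (suc i ∷ cur)) (sym (+-suc (length cur) m))

segments-consecutive : ∀ T n → Consecutive 0 (segments T n)
segments-consecutive T zero    = tt
segments-consecutive T (suc m) = segsFrom-consecutive T 1 m 0 (1 ∷ []) refl refl

segments-size : ∀ T n → sum (map length (segments T n)) ≡ n
segments-size T zero    = refl
segments-size T (suc m) = segsFrom-size T 1 m (1 ∷ [])

concat-segments : ∀ T n → concat (segments T n) ↭ ascBlock 0 n
concat-segments T n = subst (concat (segments T n) ↭_) (cong (ascBlock 0) (segments-size T n))
  (concat-consecutive 0 (segments T n) (segments-consecutive T n))

segsFrom-descent : ∀ T i m cur → isDescent T i ≡ true →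
                   segsFrom T i (suc m) cur ≡ cur ∷ segsFrom T (suc i) m (suc i ∷ [])
segsFrom-descent T i m cur descent rewrite descent = refl

segsFrom-no-descents : ∀ T lo k e M → (∀ i → lo + k ≤ i → i < lo + (k + e) → isDescent T i ≡ false) →
  segsFrom T (lo + k) (e + M) (descBlock lo k) ≡ segsFrom T (lo + (k + e)) M (descBlock lo (k + e))
segsFrom-no-descents T lo k zero    M _ rewrite +-identityʳ k = refl
segsFrom-no-descents T lo k (suc e) M no-descent
  rewrite no-descent (lo + k) ≤-refl (+-monoʳ-< lo (m<m+n k (s≤s z≤n))) = begin
    segsFrom T (suc (lo + k)) (e + M) (descBlock lo (suc k))
      ≡⟨ cong (λ i → segsFrom T i (e + M) (descBlock lo (suc k))) (sym (+-suc lo k)) ⟩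
    segsFrom T (lo + suc k) (e + M) (descBlock lo (suc k))
      ≡⟨ segsFrom-no-descents T lo (suc k) e M no-descent′ ⟩
    segsFrom T (lo + (suc k + e)) M (descBlock lo (suc k + e))
      ≡⟨ cong (λ m → segsFrom T (lo + m) M (descBlock lo m)) (sym (+-suc k e)) ⟩
    segsFrom T (lo + (k + suc e)) M (descBlock lo (k + suc e)) ∎
  where
    open ≡-Reasoning
    no-descent′ : ∀ i → lo + suc k ≤ i → i < lo + (suc k + e) → isDescent T i ≡ false
    no-descent′ i lo+k<i i< = no-descent i (≤-trans (+-monoʳ-≤ lo (n≤1+n k)) lo+k<i)
      (<-≤-trans i< (≤-reflexive (cong (lo +_) (sym (+-suc k e)))))

Block : Set
Block = ℕ × List ℕ

composition : List Block → WComp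
composition []             r = 0
composition ((k , τ) ∷ bs) r = (if ⌊ k ≟ r ⌋ then length τ else 0) + composition bs r

⌊+≟+⌋ : ∀ k r → ⌊ ℤ.+ k ℤ.≟ ℤ.+ r ⌋ ≡ ⌊ k ≟ r ⌋
⌊+≟+⌋ k r = ⌊⌋-map′ (cong (ℤ.+_)) ℤ.+-injective (k ≟ r)

compOf-composition : ∀ bs → compOf (map ℤ.+_ (map proj₁ bs)) (map proj₂ bs) ≗ composition bs
compOf-composition []             r = refl
compOf-composition ((k , τ) ∷ bs) r =
  cong₂ (λ b n → (if b then length τ else 0) + n) (⌊+≟+⌋ k r) (compOf-composition bs r)

Placed : Filling → ℕ → List Block → Set
Placed T b []             = ⊤
Placed T b ((k , τ) ∷ bs) = b < k × All (λ x → k ≤ rowPos T x) τ × Placed T k bs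

infix 4 _<head_

_<head_ : ℤ → List ℤ → Set
h <head []       = ⊤
h <head (h′ ∷ _) = h ℤ.≤ h′ ℤ.- ℤ.1ℤ

HatsOf : List ℤ → List ℕ → Set
HatsOf []       []       = ⊤
HatsOf (h ∷ hs) (t ∷ ts) = h ℤ.≤ ℤ.+ t × h <head hs × HatsOf hs ts
HatsOf _        _        = ⊥

hats-HatsOf : ∀ ts → HatsOf (hats ts) ts
hats-HatsOf []       = tt
hats-HatsOf (t ∷ ts) with hats ts | hats-HatsOf ts
... | []     | ih = ℤ.≤-refl , tt , ih
... | h ∷ hs | ih = ℤ.i⊓j≤i (ℤ.+ t) (h ℤ.- ℤ.1ℤ) , ℤ.i⊓j≤j (ℤ.+ t) (h ℤ.- ℤ.1ℤ) , ih

minRow≤ : ∀ T {x} τ → x ∈ τ → minRow T τ ≤ rowPos T x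
minRow≤ T (y ∷ [])    (here refl) = ≤-refl
minRow≤ T (y ∷ z ∷ τ) (here refl) = m⊓n≤m _ _
minRow≤ T (y ∷ z ∷ τ) (there x∈)  = ≤-trans (m⊓n≤n _ _) (minRow≤ T (z ∷ τ) x∈)

hats-placement : ∀ T b hs τs → HatsOf hs (map (minRow T) τs) → (ℤ.+ b) <head hs →
                 ∃[ bs ] map ℤ.+_ (map proj₁ bs) ≡ hs × map proj₂ bs ≡ τs × Placed T b bs
hats-placement T b []                 []       _ _ = [] , refl , refl , tt
hats-placement T b (ℤ.+ suc k ∷ hs) (τ ∷ τs) (k≤t , k≤hs , hats-hs) (+≤+ b≤k)
  with bs , hs≡ , τs≡ , placed ← hats-placement T (suc k) hs τs hats-hs k≤hs =
  (suc k , τ) ∷ bs , cong (ℤ.+ suc k ∷_) hs≡ , cong (τ ∷_) τs≡ ,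
  s≤s b≤k , All.tabulate (λ x∈τ → ≤-trans (ℤ.drop‿+≤+ k≤t) (minRow≤ T τ x∈τ)) , placed

segmentsOf : Filling → List (List ℕ)
segmentsOf T = segments T (length (concat T))

-- The blocks are the pairs (t̂ᵢ , τ⁽ⁱ⁾) of the paper.
record Placement (T : Filling) (d : WComp) : Set where
  field
    blocks       : List Block
    segments≡    : map proj₂ blocks ≡ segmentsOf T
    placed       : Placed T 0 blocks
    composition≗ : d ≗ composition blocks

des-placement : ∀ T {d} → des T ≡ just d → Placement T d
des-placement T des≡ with hats (map (minRow T) (segmentsOf T)) | hats-HatsOf (map (minRow T) (segmentsOf T))
des-placement T refl | [] | hats-none = record
  { blocks = [] ; segments≡ = none-segs (segmentsOf T) hats-none ; placed = tt ; composition≗ = λ r → refl }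
  where
    none-segs : ∀ τs → HatsOf [] (map (minRow T) τs) → [] ≡ τs
    none-segs [] _ = refl
des-placement T des≡ | ℤ.+ suc k ∷ hs | hats-hs
  with bs , hs≡ , τs≡ , placed ← hats-placement T 0 (ℤ.+ suc k ∷ hs) (segmentsOf T) hats-hs (+≤+ z≤n)
  with refl ← des≡ = record
  { blocks       = bs
  ; segments≡    = τs≡
  ; placed       = placed
  ; composition≗ = λ r → trans (cong₂ (λ hs τs → compOf hs τs r) (sym hs≡) (sym τs≡))
                               (compOf-composition bs r)
  }

minRow-const : ∀ T k y τ → All (λ x → rowPos T x ≡ k) (y ∷ τ) → minRow T (y ∷ τ) ≡ k
minRow-const T k y []      (y≡k ∷ [])   = y≡k
minRow-const T k y (z ∷ τ) (y≡k ∷ τ≡k) =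
  trans (cong₂ _⊓_ y≡k (minRow-const T k z τ τ≡k)) (⊓-idem k)

hats-increasing : ∀ ks → Linked _<_ ks → hats ks ≡ map ℤ.+_ ks
hats-increasing []                 _           = refl
hats-increasing (k ∷ [])           _           = refl
hats-increasing (k ∷ suc k′ ∷ ks) (k<k′ ∷ inc) rewrite hats-increasing (suc k′ ∷ ks) inc =
  cong (λ h → h ∷ ℤ.+ suc k′ ∷ map ℤ.+_ ks) (cong ℤ.+_ (m≤n⇒m⊓n≡m (s≤s⁻¹ k<k′)))

des-from-placement : ∀ T bs → map proj₂ bs ≡ segmentsOf T → map (minRow T) (segmentsOf T) ≡ map proj₁ bs →
                     Linked _<_ (0 ∷ map proj₁ bs) → ∃[ d ] des T ≡ just d × d ≗ composition bs
des-from-placement T bs segs≡ minRows≡ inc with hats (map (minRow T) (segmentsOf T)) in hats≡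
... | hs with trans (sym hats≡) (trans (cong hats minRows≡) (hats-increasing _ (Linked.tail inc)))
des-from-placement T []                   segs≡ minRows≡ _ | _ | refl = (λ _ → 0) , refl , λ r → refl
des-from-placement T ((zero , τ) ∷ bs)  _     _        (() ∷ _) | _ | _
des-from-placement T ((suc k , τ) ∷ bs) segs≡ minRows≡ _ | _ | refl =
  _ , refl , λ r → trans (cong (λ τs → compOf (map ℤ.+_ (map proj₁ ((suc k , τ) ∷ bs))) τs r) (sym segs≡))
                         (compOf-composition ((suc k , τ) ∷ bs) r)

composition-below : ∀ q bs r → Linked _<_ (q ∷ map proj₁ bs) → r ≤ q → composition bs r ≡ 0
composition-below q []             r _           _   = refl
composition-below q ((k , τ) ∷ bs) r (q<k ∷ inc) r≤q with k ≟ r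
... | yes refl = contradiction r≤q (<⇒≱ q<k)
... | no _     = composition-below k bs r inc (≤-trans r≤q (<⇒≤ q<k))

-- Entries in the lowest rows

sizeUpTo : ℕ → List Block → ℕ
sizeUpTo j []             = 0
sizeUpTo j ((k , τ) ∷ bs) = (if ⌊ k ≤? j ⌋ then length τ else 0) + sizeUpTo j bs

psum-indicator : ∀ k c j →
  psum (λ r → if ⌊ suc k ≟ r ⌋ then c else 0) j ≡ (if ⌊ suc k ≤? j ⌋ then c else 0)
psum-indicator k c zero = refl
psum-indicator k c (suc j) rewrite psum-indicator k c j with suc k ≤? j | suc k ≤? suc j | suc k ≟ suc j
... | yes _   | yes _   | no _     = +-identityʳ c
... | yes k<j | _       | yes refl = contradiction k<j (n≮n k)
... | yes k<j | no k≰j  | no _     = contradiction (m≤n⇒m≤1+n k<j) k≰j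
... | no _    | yes _   | yes refl = refl
... | no k≮j  | yes k≤j | no k≢j   = contradiction (cong suc (≤-antisym (s≤s⁻¹ k≤j) (≮⇒≥ k≮j))) k≢j
... | no _    | no k≰j  | yes refl = contradiction ≤-refl k≰j
... | no _    | no _    | no _     = refl

psum-composition : ∀ T b bs j → Placed T b bs → psum (composition bs) j ≡ sizeUpTo j bs
psum-composition T b []                   j _ = psum-zero _ j (λ r → refl)
psum-composition T b ((suc k , τ) ∷ bs) j (_ , _ , placed) =
  trans (psum-+ _ (composition bs) j)
        (cong₂ _+_ (psum-indicator k (length τ) j) (psum-composition T (suc k) bs j placed))

sizeUpTo-below : ∀ T b bs j → Placed T b bs → j ≤ b → sizeUpTo j bs ≡ 0
sizeUpTo-below T b []             j _                  j≤b = refl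
sizeUpTo-below T b ((k , τ) ∷ bs) j (b<k , _ , placed) j≤b with k ≤? j
... | yes k≤j = contradiction k≤j (<⇒≱ (≤-<-trans j≤b b<k))
... | no _    = sizeUpTo-below T k bs j placed (≤-trans j≤b (<⇒≤ b<k))

entriesUpTo : Filling → ℕ → List ℕ → ℕ
entriesUpTo T j = count (λ x → rowPos T x ≤? j)

entriesUpTo-block : ∀ T j k τ → All (λ x → k ≤ rowPos T x) τ →
                    entriesUpTo T j τ ≤ (if ⌊ k ≤? j ⌋ then length τ else 0)
entriesUpTo-block T j k τ k≤rows with k ≤? j
... | yes _   = count≤length _ τ
... | no k≰j  = ≤-reflexive (count-none _ (All.map (λ k≤row row≤j → k≰j (≤-trans k≤row row≤j)) k≤rows))

entriesUpTo≤sizeUpTo : ∀ T b bs j → Placed T b bs → sum (map (entriesUpTo T j) (map proj₂ bs)) ≤ sizeUpTo j bs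
entriesUpTo≤sizeUpTo T b []             j _ = z≤n
entriesUpTo≤sizeUpTo T b ((k , τ) ∷ bs) j (_ , k≤rows , placed) =
  +-mono-≤ (entriesUpTo-block T j k τ k≤rows) (entriesUpTo≤sizeUpTo T k bs j placed)

OnRows : Filling → List Block → Set
OnRows T []             = ⊤
OnRows T ((k , τ) ∷ bs) = All (λ x → rowPos T x ≡ k) τ × OnRows T bs

placed-onRows : ∀ T b bs → Placed T b bs →
                (∀ j → sizeUpTo j bs ≤ sum (map (entriesUpTo T j) (map proj₂ bs))) → OnRows T bs
placed-onRows T b []             _                       _     = tt
placed-onRows T b ((k , τ) ∷ bs) (_ , k≤rows , placed) size≤ =
  All.zipWith (λ (row≤k , k≤row) → ≤-antisym row≤k k≤row) (count-complete _ τ τ-low , k≤rows) ,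
  placed-onRows T k bs placed (λ j → proj₂ (split j))
  where
    -- both summands are bounded termwise, so the total bound forces both to be tight
    split : ∀ j → (if ⌊ k ≤? j ⌋ then length τ else 0) ≤ entriesUpTo T j τ ×
                  sizeUpTo j bs ≤ sum (map (entriesUpTo T j) (map proj₂ bs))
    split j = +-cancelʳ-≤ _ _ _ (≤-trans (size≤ j) (+-monoʳ-≤ _ (entriesUpTo≤sizeUpTo T k bs j placed))) ,
              +-cancelˡ-≤ _ _ _ (≤-trans (size≤ j) (+-monoˡ-≤ _ (entriesUpTo-block T j k τ k≤rows)))
    τ-low : length τ ≤ entriesUpTo T k τ
    τ-low with k ≤? k | proj₁ (split k)
    ... | yes _   | τ≤ = τ≤
    ... | no  k≰k | _  = contradiction ≤-refl k≰k

placed-rowPos> : ∀ T b bs {x} → Placed T b bs → x ∈ concat (map proj₂ bs) → b < rowPos T x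
placed-rowPos> T b ((k , τ) ∷ bs) (b<k , k≤rows , placed) x∈ with ∈-++⁻ τ x∈
... | inj₁ x∈τ  = <-≤-trans b<k (All.lookup k≤rows x∈τ)
... | inj₂ x∈bs = <-trans b<k (placed-rowPos> T k bs placed x∈bs)

consecutive-lower : ∀ lo τs {x} → Consecutive lo τs → x ∈ concat τs → lo < x
consecutive-lower lo τs cons x∈ = proj₁ (∈-ascBlock⁻ lo _ (∈-resp-↭ (concat-consecutive lo τs cons) x∈))

rowPos≤⇔ : ∀ T lo b bs j {x} → Placed T b bs → OnRows T bs → Consecutive lo (map proj₂ bs) →
           x ∈ concat (map proj₂ bs) → rowPos T x ≤ j ⇔ x ≤ lo + sizeUpTo j bs
rowPos≤⇔ T lo b ((k , τ) ∷ bs) j {x} (_ , _ , placed) (on-k , on-bs) (τ≡ , cons) x∈ with k ≤? j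
... | yes k≤j with ∈-++⁻ τ x∈
...   | inj₁ x∈τ  = mk⇔ (λ _ → ≤-trans (proj₂ (∈-descBlock⁻ lo (length τ) (subst (x ∈_) τ≡ x∈τ)))
                                       (+-monoʳ-≤ lo (m≤m+n (length τ) _)))
                        (λ _ → subst (_≤ j) (sym (All.lookup on-k x∈τ)) k≤j)
...   | inj₂ x∈bs = subst (λ n → rowPos T x ≤ j ⇔ x ≤ n) (+-assoc lo (length τ) _)
                      (rowPos≤⇔ T (lo + length τ) k bs j placed on-bs cons x∈bs)
rowPos≤⇔ T lo b ((k , τ) ∷ bs) j {x} (_ , _ , placed) (on-k , on-bs) (τ≡ , cons) x∈ | no k≰j =
  mk⇔ (λ row≤j → contradiction row≤j (<⇒≱ j<row))
      (λ x≤ → contradiction (≤-trans x≤ (≤-reflexive lo+size≡lo)) (<⇒≱ lo<x))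
  where
    j<k : j < k
    j<k = ≰⇒> k≰j
    lo+size≡lo : lo + sizeUpTo j bs ≡ lo
    lo+size≡lo = trans (cong (lo +_) (sizeUpTo-below T k bs j placed (<⇒≤ j<k))) (+-identityʳ lo)
    j<row : j < rowPos T x
    j<row with ∈-++⁻ τ x∈
    ... | inj₁ x∈τ  = subst (j <_) (sym (All.lookup on-k x∈τ)) j<k
    ... | inj₂ x∈bs = <-trans j<k (placed-rowPos> T k bs placed x∈bs)
    lo<x : lo < x
    lo<x = consecutive-lower lo (τ ∷ map proj₂ bs) (τ≡ , cons) x∈

rowOf-∈-concat : ∀ {x} T r → x ∈ rowOf T r → x ∈ concat T
rowOf-∈-concat (ρ ∷ T) (suc zero)    x∈ = ∈-++⁺ˡ x∈
rowOf-∈-concat (ρ ∷ T) (suc (suc r)) x∈ = ∈-++⁺ʳ ρ (rowOf-∈-concat T (suc r) x∈)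

module _ {a T} (skt : SKT a T) where
  open SKT skt

  length-concat : length (concat T) ≡ n-of a
  length-concat = trans (↭-length bijective) (trans (length-map suc (upTo (n-of a))) (length-upTo (n-of a)))

  concat↭segments : concat T ↭ concat (segmentsOf T)
  concat↭segments = begin
    concat T                        ↭⟨ bijective ⟩
    map suc (upTo (n-of a))         ≡⟨ map-suc-upTo _ ⟩
    ascBlock 0 (n-of a)             ≡⟨ cong (ascBlock 0) (sym length-concat) ⟩
    ascBlock 0 (length (concat T))  ↭⟨ ↭-sym (concat-segments T _) ⟩
    concat (segmentsOf T)           ∎
    where open PermutationReasoning

  part≡length-rowOf : ∀ r → part a r ≡ length (rowOf T r)
  part≡length-rowOf r = trans (cong (λ b → part b r) (sym shape)) (part-map-length T r)

  psum-part≡rowSum : ∀ j → psum (part a) j ≡ rowSum (entriesUpTo T j) T j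
  psum-part≡rowSum j = psum-cong _ _ j λ where
    (suc r) _ r+1≤j → trans (part≡length-rowOf (suc r))
      (sym (count-all _ (All.tabulate (λ x∈ → ≤-trans (rowPos≤ T r x∈) r+1≤j))))

  psum-part≤entriesUpTo : ∀ j → psum (part a) j ≤ entriesUpTo T j (concat T)
  psum-part≤entriesUpTo j = begin
    psum (part a) j                       ≡⟨ psum-part≡rowSum j ⟩
    rowSum (entriesUpTo T j) T j          ≤⟨ rowSum≤sum _ T j refl ⟩
    sum (map (entriesUpTo T j) T)         ≡⟨ sym (count-concat _ T) ⟩
    entriesUpTo T j (concat T)            ∎
    where open ≤-Reasoning

  module _ {d} (des≡ : des T ≡ just d) where
    open Placement (des-placement T des≡)

    psum-d : ∀ j → psum d j ≡ sizeUpTo j blocks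
    psum-d j = trans (psum-cong _ _ j (λ r _ _ → composition≗ r))
                     (psum-composition T 0 blocks j placed)

    entriesUpTo-blocks : ∀ j → entriesUpTo T j (concat T) ≡ sum (map (entriesUpTo T j) (map proj₂ blocks))
    entriesUpTo-blocks j = begin
      entriesUpTo T j (concat T)                      ≡⟨ count-↭ _ concat↭segments ⟩
      entriesUpTo T j (concat (segmentsOf T))         ≡⟨ cong (entriesUpTo T j ∘ concat) (sym segments≡) ⟩
      entriesUpTo T j (concat (map proj₂ blocks))     ≡⟨ count-concat _ (map proj₂ blocks) ⟩
      sum (map (entriesUpTo T j) (map proj₂ blocks))  ∎
      where open ≡-Reasoning

    entriesUpTo≤psum : ∀ j → entriesUpTo T j (concat T) ≤ psum d j
    entriesUpTo≤psum j = begin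
      entriesUpTo T j (concat T)                      ≡⟨ entriesUpTo-blocks j ⟩
      sum (map (entriesUpTo T j) (map proj₂ blocks))  ≤⟨ entriesUpTo≤sizeUpTo T 0 blocks j placed ⟩
      sizeUpTo j blocks                               ≡⟨ sym (psum-d j) ⟩
      psum d j                                        ∎
      where open ≤-Reasoning

    dominates : d ⊵ part a
    dominates j = ≤-trans (psum-part≤entriesUpTo j) (entriesUpTo≤psum j)

    module _ (d≈a : d ≈wc part a) where

      sizeUpTo≡psum-part : ∀ j → sizeUpTo j blocks ≡ psum (part a) j
      sizeUpTo≡psum-part j = trans (sym (psum-d j)) (psum-cong _ _ j (λ r 1≤r _ → d≈a r 1≤r))

      entriesUpTo≡psum-part : ∀ j → entriesUpTo T j (concat T) ≡ psum (part a) j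
      entriesUpTo≡psum-part j = ≤-antisym
        (≤-trans (entriesUpTo≤psum j) (≤-reflexive (trans (psum-d j) (sizeUpTo≡psum-part j))))
        (psum-part≤entriesUpTo j)

      rowPos-rowOf : ∀ r {y} → y ∈ rowOf T (suc r) → rowPos T y ≡ suc r
      rowPos-rowOf r y∈ = ≤-antisym (rowPos≤ T r y∈) (≰⇒> (All.lookup (count-zero _ _ row-high) y∈))
        where
          -- rows 1, …, r already account for all the entries lying in rows ≤ r
          g : List ℕ → ℕ
          g = entriesUpTo T r
          row-high : g (rowOf T (suc r)) ≡ 0
          row-high = n≤0⇒n≡0 (+-cancelˡ-≤ (rowSum g T r) _ 0 (begin
            rowSum g T r + g (rowOf T (suc r)) ≤⟨ rowSum≤sum g T (suc r) refl ⟩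
            sum (map g T)                      ≡⟨ sym (count-concat _ T) ⟩
            g (concat T)                       ≡⟨ entriesUpTo≡psum-part r ⟩
            psum (part a) r                    ≡⟨ psum-part≡rowSum r ⟩
            rowSum g T r                       ≡⟨ sym (+-identityʳ _) ⟩
            rowSum g T r + 0                   ∎))
            where open ≤-Reasoning

      onRows : OnRows T blocks
      onRows = placed-onRows T 0 blocks placed λ j → begin
        sizeUpTo j blocks                               ≡⟨ sizeUpTo≡psum-part j ⟩
        psum (part a) j                                 ≤⟨ psum-part≤entriesUpTo j ⟩
        entriesUpTo T j (concat T)                      ≡⟨ entriesUpTo-blocks j ⟩
        sum (map (entriesUpTo T j) (map proj₂ blocks))  ∎
        where open ≤-Reasoning

      rowOf≡descBlock : ∀ r → rowOf T (suc r) ≡ descBlock (psum (part a) r) (part a (suc r))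
      rowOf≡descBlock r = trans
        (decreasing⇒descBlock (psum (part a) r) (rowOf T (suc r))
          (nth⇒decreasing _ (rowDecr (suc r))) (All.tabulate bounds))
        (cong (descBlock _) (sym (part≡length-rowOf (suc r))))
        where
          -- the entries lying in rows ≤ j are exactly 1, …, S_j
          prefix : ∀ {y} j → y ∈ rowOf T (suc r) → rowPos T y ≤ j ⇔ y ≤ sizeUpTo j blocks
          prefix j y∈ = rowPos≤⇔ T 0 0 blocks j placed onRows
            (subst (Consecutive 0) (sym segments≡) (segments-consecutive T (length (concat T))))
            (subst (λ τs → _ ∈ concat τs) (sym segments≡)
                   (∈-resp-↭ concat↭segments (rowOf-∈-concat T (suc r) y∈)))
          bounds : ∀ {y} → y ∈ rowOf T (suc r) →
                   psum (part a) r < y × y ≤ psum (part a) r + length (rowOf T (suc r))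
          bounds y∈ =
            ≰⇒> (λ y≤ → contradiction
                          (Equivalence.from (prefix r y∈) (subst (_ ≤_) (sym (sizeUpTo≡psum-part r)) y≤))
                          (subst (_≰ r) (sym (rowPos-rowOf r y∈)) (n≮n r))) ,
            subst (_ ≤_) (trans (sizeUpTo≡psum-part (suc r)) (cong (psum (part a) r +_) (part≡length-rowOf (suc r))))
                  (Equivalence.to (prefix (suc r) y∈) (≤-reflexive (rowPos-rowOf r y∈)))

-- The tableau T_a

stackRows : ℕ → List ℕ → Filling
stackRows lo []      = []
stackRows lo (x ∷ a) = descBlock lo x ∷ stackRows (lo + x) a

canonicalTableau : List ℕ → Filling
canonicalTableau = stackRows 0

rowOf-stackRows : ∀ lo a r → rowOf (stackRows lo a) (suc r) ≡ descBlock (lo + psum (part a) r) (part a (suc r))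
rowOf-stackRows lo []      r       = refl
rowOf-stackRows lo (x ∷ a) zero    = cong (λ l → descBlock l x) (sym (+-identityʳ lo))
rowOf-stackRows lo (x ∷ a) (suc r) = trans (rowOf-stackRows (lo + x) a r)
  (cong (λ l → descBlock l (part a (suc r))) (trans (+-assoc lo x _) (cong (lo +_) (sym (psum-part-∷ x a r)))))

map-length-stackRows : ∀ lo a → map length (stackRows lo a) ≡ a
map-length-stackRows lo []      = refl
map-length-stackRows lo (x ∷ a) = cong₂ _∷_ (length-descBlock lo x) (map-length-stackRows (lo + x) a)

stackRows-consecutive : ∀ lo a → Consecutive lo (stackRows lo a)
stackRows-consecutive lo []      = tt
stackRows-consecutive lo (x ∷ a) rewrite length-descBlock lo x = refl , stackRows-consecutive (lo + x) a

rowOf-ext : ∀ T T′ → length T ≡ length T′ → (∀ r → rowOf T (suc r) ≡ rowOf T′ (suc r)) → T ≡ T′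
rowOf-ext []      []        _       _    = refl
rowOf-ext (ρ ∷ T) (ρ′ ∷ T′) len≡ rows≡ =
  cong₂ _∷_ (rows≡ 0) (rowOf-ext T T′ (suc-injective len≡) (λ r → rows≡ (suc r)))

nth-∈ : ∀ {x} xs c → nth xs c ≡ just x → x ∈ xs
nth-∈ (y ∷ xs) (suc zero)    refl = here refl
nth-∈ (y ∷ xs) (suc (suc c)) x≡   = there (nth-∈ xs (suc c) x≡)

∈-rowOf-canonical : ∀ a r {x} → x ∈ rowOf (canonicalTableau a) (suc r) →
                    psum (part a) r < x × x ≤ psum (part a) (suc r)
∈-rowOf-canonical a r x∈ = ∈-descBlock⁻ _ _ (subst (_ ∈_) (rowOf-stackRows 0 a r) x∈)

canonical-SKT : ∀ a → SKT a (canonicalTableau a)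
canonical-SKT a = record
  { shape     = map-length-stackRows 0 a
  ; bijective = begin
      concat (stackRows 0 a)                             ↭⟨ concat-consecutive 0 _ (stackRows-consecutive 0 a) ⟩
      ascBlock 0 (sum (map length (stackRows 0 a)))      ≡⟨ cong (ascBlock 0 ∘ sum) (map-length-stackRows 0 a) ⟩
      ascBlock 0 (sum a)                                 ≡⟨ sym (map-suc-upTo (sum a)) ⟩
      map suc (upTo (n-of a))                            ∎
  ; rowDecr   = row-decreasing
  ; colCond   = column-condition
  }
  where
    open PermutationReasoning
    row-decreasing : ∀ r c x y → cell (canonicalTableau a) r c ≡ just x →
                     cell (canonicalTableau a) r (suc c) ≡ just y → y < x
    row-decreasing (suc r) c x y rewrite rowOf-stackRows 0 a r = decreasing⇒nth _ (descBlock-decreasing _ _) c x y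
    -- every entry of a higher row exceeds every entry of a lower row, so the premise i < k never holds
    column-condition : ∀ r r′ c i k → r < r′ → cell (canonicalTableau a) r′ c ≡ just i →
                       cell (canonicalTableau a) r c ≡ just k → i < k →
                       ∃[ c′ ] ∃[ j ] (c < c′ × cell (canonicalTableau a) r c′ ≡ just j × i < j)
    column-condition zero    _        zero    _ _ _          _  () _
    column-condition zero    _        (suc c) _ _ _          _  () _
    column-condition (suc r) (suc r′) c       i k (s≤s r<r′) i∈ k∈ i<k = contradiction i<k (<⇒≯ k<i)
      where
        k<i : k < i
        k<i = ≤-<-trans (proj₂ (∈-rowOf-canonical a r (nth-∈ _ c k∈)))
                (≤-<-trans (psum-mono (part a) r<r′) (proj₁ (∈-rowOf-canonical a r′ (nth-∈ _ c i∈))))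

colIn-descBlock : ∀ c lo L {x} → lo < x → x ≤ lo + L → colIn c (descBlock lo L) x ≡ just (c + (lo + L ∸ x))
colIn-descBlock c lo zero    lo<x x≤ = contradiction (≤-trans x≤ (≤-reflexive (+-identityʳ lo))) (<⇒≱ lo<x)
colIn-descBlock c lo (suc L) {x} lo<x x≤ rewrite +-suc lo L with m≤n⇒m<n∨m≡n x≤
... | inj₂ refl rewrite ≡ᵇ-refl (lo + L) = cong just (sym (trans (cong (c +_) (n∸n≡0 (lo + L))) (+-identityʳ c)))
... | inj₁ x<top with suc (lo + L) ≡ᵇ x in top≡ᵇx
...   | true  = contradiction (≡ᵇ⇒≡ _ _ (Equivalence.from T-≡ top≡ᵇx)) (>⇒≢ x<top)
...   | false = trans (colIn-descBlock (suc c) lo L lo<x (s≤s⁻¹ x<top))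
                      (cong just (trans (sym (+-suc c _)) (cong (c +_) (sym (+-∸-assoc 1 (s≤s⁻¹ x<top))))))

infixr 5 _∷⁺_

_∷⁺_ : Block → List Block → List Block
(k , [])    ∷⁺ bs = bs
(k , x ∷ τ) ∷⁺ bs = (k , x ∷ τ) ∷ bs

module Canonical (a : List ℕ) where

  Tₐ : Filling
  Tₐ = canonicalTableau a

  S : ℕ → ℕ
  S = psum (part a)

  N : ℕ
  N = n-of a

  posFrom-canonical : ∀ r x → S r < x → x ≤ S (suc r) → posFrom 1 Tₐ x ≡ (suc r , suc (S (suc r) ∸ x))
  posFrom-canonical r x S<x x≤S = posFrom-first Tₐ 1 r earlier found
    where
      earlier : ∀ r′ → r′ < r → All (_≢ x) (rowOf Tₐ (suc r′))
      earlier r′ r′<r = All.tabulate λ y∈ y≡x → <⇒≱ S<x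
        (≤-trans (≤-reflexive (sym y≡x))
                 (≤-trans (proj₂ (∈-rowOf-canonical a r′ y∈)) (psum-mono (part a) r′<r)))
      found : colIn 1 (rowOf Tₐ (suc r)) x ≡ just (suc (S (suc r) ∸ x))
      found rewrite rowOf-stackRows 0 a r = colIn-descBlock 1 (S r) (part a (suc r)) S<x x≤S

  rowPos-canonical : ∀ r x → S r < x → x ≤ S (suc r) → rowPos Tₐ x ≡ suc r
  rowPos-canonical r x S<x x≤S = trans (rowPos-posFrom Tₐ x) (cong proj₁ (posFrom-canonical r x S<x x≤S))

  colPos-canonical : ∀ r x → S r < x → x ≤ S (suc r) → colPos Tₐ x ≡ suc (S (suc r) ∸ x)
  colPos-canonical r x S<x x≤S = trans (colPos-posFrom Tₐ x) (cong proj₂ (posFrom-canonical r x S<x x≤S))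

  not-descent : ∀ q x → S q < x → suc x ≤ S (suc q) → isDescent Tₐ x ≡ false
  not-descent q x S<x x<S = trans
    (cong₂ _≤ᵇ_ (colPos-canonical q x S<x (<⇒≤ x<S)) (colPos-canonical q (suc x) (m<n⇒m<1+n S<x) x<S))
    (dec-false (suc (S (suc q) ∸ x) ≤? suc (S (suc q) ∸ suc x))
               (λ col≤ → <⇒≱ (∸-monoʳ-< (n<1+n x) x<S) (s≤s⁻¹ col≤)))

  ∈-concat-canonical : ∀ x → 1 ≤ x → x ≤ N → x ∈ concat Tₐ
  ∈-concat-canonical x 1≤x x≤N = ∈-resp-↭ (↭-sym (SKT.bijective (canonical-SKT a)))
    (subst (x ∈_) (sym (map-suc-upTo N)) (∈-ascBlock⁺ 0 N 1≤x x≤N))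

  -- the largest entry of a row sits in column 1, so whatever follows it is weakly to the right
  descent : ∀ q → S q < S (suc q) → S (suc q) < N → isDescent Tₐ (S (suc q)) ≡ true
  descent q S<S S<N = trans (cong (_≤ᵇ colPos Tₐ (suc (S (suc q)))) col≡1)
    (dec-true (1 ≤? colPos Tₐ (suc (S (suc q)))) (colPos≥1 Tₐ (∈-concat-canonical _ (s≤s z≤n) S<N)))
    where
      col≡1 : colPos Tₐ (S (suc q)) ≡ 1
      col≡1 = trans (colPos-canonical q _ S<S ≤-refl) (cong suc (n∸n≡0 (S (suc q))))

  rowBlocks : ℕ → ℕ → List Block
  rowBlocks q zero    = []
  rowBlocks q (suc f) = (suc q , descBlock (S q) (part a (suc q))) ∷⁺ rowBlocks (suc q) f

  S≡N : ∀ q → length a ≤ q → S q ≡ N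
  S≡N q len≤q = ≤-antisym (psum-part≤sum a q)
    (≤-trans (≤-reflexive (sym (psum-part-length a))) (psum-mono (part a) len≤q))

  rowBlocks-nil : ∀ f q → S q ≡ N → rowBlocks q f ≡ []
  rowBlocks-nil zero    q _   = refl
  rowBlocks-nil (suc f) q S≡ with part a (suc q) in row≡
  ... | zero  = rowBlocks-nil f (suc q) (trans (cong (S q +_) row≡) (trans (+-identityʳ (S q)) S≡))
  ... | suc L = contradiction
    (≤-trans (≤-reflexive (cong (S q +_) (sym row≡))) (≤-trans (psum-part≤sum a (suc q)) (≤-reflexive (sym S≡))))
    (<⇒≱ (m<m+n (S q) (s≤s z≤n)))

  segsFrom-across-row : ∀ q L M → part a (suc q) ≡ suc L → S q + suc M ≡ N →
    ∃[ M′ ] S (suc q) + M′ ≡ N ×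
            segsFrom Tₐ (suc (S q)) M (suc (S q) ∷ []) ≡ segsFrom Tₐ (S (suc q)) M′ (descBlock (S q) (suc L))
  segsFrom-across-row q L M row≡ S+M≡ with M′ , S′+M′≡N ← m≤n⇒∃[o]m+o≡n (psum-part≤sum a (suc q)) =
    M′ , S′+M′≡N , (begin
    segsFrom Tₐ (suc (S q)) M (suc (S q) ∷ [])
      ≡⟨ cong (λ s → segsFrom Tₐ (suc (S q)) M (suc s ∷ [])) (sym (+-identityʳ (S q))) ⟩
    segsFrom Tₐ (1 + S q) M (descBlock (S q) 1)
      ≡⟨ cong₂ (λ i m → segsFrom Tₐ i m (descBlock (S q) 1)) (+-comm 1 (S q)) M≡L+M′ ⟩
    segsFrom Tₐ (S q + 1) (L + M′) (descBlock (S q) 1)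
      ≡⟨ segsFrom-no-descents Tₐ (S q) 1 L M′ inside-row ⟩
    segsFrom Tₐ (S q + suc L) M′ (descBlock (S q) (suc L))
      ≡⟨ cong (λ i → segsFrom Tₐ i M′ (descBlock (S q) (suc L))) (sym S′≡) ⟩
    segsFrom Tₐ (S (suc q)) M′ (descBlock (S q) (suc L)) ∎)
    where
      open ≡-Reasoning
      S′≡ : S (suc q) ≡ S q + suc L
      S′≡ = cong (S q +_) row≡
      M≡L+M′ : M ≡ L + M′
      M≡L+M′ = suc-injective (+-cancelˡ-≡ (S q) _ _ (begin
        S q + suc M           ≡⟨ S+M≡ ⟩
        N                     ≡⟨ sym S′+M′≡N ⟩
        S (suc q) + M′        ≡⟨ cong (_+ M′) S′≡ ⟩
        S q + suc L + M′      ≡⟨ +-assoc (S q) (suc L) M′ ⟩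
        S q + suc (L + M′)    ∎))
      inside-row : ∀ i → S q + 1 ≤ i → i < S q + (1 + L) → isDescent Tₐ i ≡ false
      inside-row i S<i i< = not-descent q i (≤-trans (≤-reflexive (+-comm 1 (S q))) S<i)
                                          (≤-trans i< (≤-reflexive (sym S′≡)))

  segsFrom-canonical : ∀ f q M → length a ≤ q + f → S q + suc M ≡ N →
                       segsFrom Tₐ (suc (S q)) M (suc (S q) ∷ []) ≡ map proj₂ (rowBlocks q f)
  segsFrom-canonical zero    q M len≤ S+M≡ =
    contradiction (trans S+M≡ (sym (S≡N q (≤-trans len≤ (≤-reflexive (+-identityʳ q))))))
                  (>⇒≢ (m<m+n (S q) (s≤s z≤n)))
  segsFrom-canonical (suc f) q M len≤ S+M≡ with part a (suc q) in row≡
  ... | zero = trans (cong (λ s → segsFrom Tₐ (suc s) M (suc s ∷ [])) (sym S′≡S))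
                     (segsFrom-canonical f (suc q) M len≤′ (trans (cong (_+ suc M) S′≡S) S+M≡))
    where
      S′≡S : S (suc q) ≡ S q
      S′≡S = trans (cong (S q +_) row≡) (+-identityʳ (S q))
      len≤′ : length a ≤ suc q + f
      len≤′ = ≤-trans len≤ (≤-reflexive (+-suc q f))
  ... | suc L with segsFrom-across-row q L M row≡ S+M≡
  ...   | zero , S′≡N , across = trans across
    (cong (λ bs → descBlock (S q) (suc L) ∷ map proj₂ bs)
          (sym (rowBlocks-nil f (suc q) (trans (sym (+-identityʳ _)) S′≡N))))
  ...   | suc M″ , S′+M″≡N , across =
    trans across (trans (segsFrom-descent Tₐ (S (suc q)) M″ _ (descent q S<S′ S′<N))
                        (cong (descBlock (S q) (suc L) ∷_) (segsFrom-canonical f (suc q) M″ len≤′ S′+M″≡N)))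
    where
      S<S′ : S q < S (suc q)
      S<S′ = ≤-trans (m<m+n (S q) (s≤s z≤n)) (≤-reflexive (sym (cong (S q +_) row≡)))
      S′<N : S (suc q) < N
      S′<N = ≤-trans (s≤s (m≤m+n (S (suc q)) M″))
                     (≤-reflexive (trans (sym (+-suc (S (suc q)) M″)) S′+M″≡N))
      len≤′ : length a ≤ suc q + f
      len≤′ = ≤-trans len≤ (≤-reflexive (+-suc q f))

  segments-canonical : segmentsOf Tₐ ≡ map proj₂ (rowBlocks 0 (length a))
  segments-canonical = from-length (length (concat Tₐ)) (length-concat (canonical-SKT a))
    where
      from-length : ∀ n → n ≡ N → segments Tₐ n ≡ map proj₂ (rowBlocks 0 (length a))
      from-length zero    0≡N    = cong (map proj₂) (sym (rowBlocks-nil (length a) 0 0≡N))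
      from-length (suc m) 1+m≡N = segsFrom-canonical (length a) 0 m ≤-refl 1+m≡N

  minRow-rowBlocks : ∀ f q → map (minRow Tₐ) (map proj₂ (rowBlocks q f)) ≡ map proj₁ (rowBlocks q f)
  minRow-rowBlocks zero    q = refl
  minRow-rowBlocks (suc f) q with part a (suc q) in row≡
  ... | zero  = minRow-rowBlocks f (suc q)
  ... | suc L = cong₂ _∷_ (minRow-const Tₐ (suc q) _ _ (All.tabulate on-row)) (minRow-rowBlocks f (suc q))
    where
      on-row : ∀ {x} → x ∈ descBlock (S q) (suc L) → rowPos Tₐ x ≡ suc q
      on-row x∈ with S<x , x≤ ← ∈-descBlock⁻ (S q) (suc L) x∈ =
        rowPos-canonical q _ S<x (≤-trans x≤ (≤-reflexive (cong (S q +_) (sym row≡))))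

  rowBlocks-increasing : ∀ f q → Linked _<_ (q ∷ map proj₁ (rowBlocks q f))
  rowBlocks-increasing zero    q = [-]
  rowBlocks-increasing (suc f) q with part a (suc q)
  ... | zero  = weaken-head (rowBlocks-increasing f (suc q))
    where
      weaken-head : ∀ {ks} → Linked _<_ (suc q ∷ ks) → Linked _<_ (q ∷ ks)
      weaken-head [-]       = [-]
      weaken-head (q<k ∷ l) = <-trans (n<1+n q) q<k ∷ l
  ... | suc L = n<1+n q ∷ rowBlocks-increasing f (suc q)

  composition-rowBlocks : ∀ f q r → length a ≤ q + f → q < r → composition (rowBlocks q f) r ≡ part a r
  composition-rowBlocks zero    q r len≤ q<r =
    sym (part-beyond a r (≤-<-trans (≤-trans len≤ (≤-reflexive (+-identityʳ q))) q<r))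
  composition-rowBlocks (suc f) q r len≤ q<r with part a (suc q) in row≡
  ... | zero with suc q ≟ r
  ...   | yes refl = trans (composition-below (suc q) _ (suc q) (rowBlocks-increasing f (suc q)) ≤-refl) (sym row≡)
  ...   | no q+1≢r =
    composition-rowBlocks f (suc q) r (≤-trans len≤ (≤-reflexive (+-suc q f))) (≤∧≢⇒< q<r q+1≢r)
  composition-rowBlocks (suc f) q r len≤ q<r | suc L with suc q ≟ r
  ...   | yes refl = begin
    length (descBlock (S q) (suc L)) + composition (rowBlocks (suc q) f) (suc q)
      ≡⟨ cong₂ _+_ (length-descBlock (S q) (suc L))
                   (composition-below (suc q) _ (suc q) (rowBlocks-increasing f (suc q)) ≤-refl) ⟩
    suc L + 0      ≡⟨ +-identityʳ (suc L) ⟩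
    suc L          ≡⟨ sym row≡ ⟩
    part a (suc q) ∎
    where open ≡-Reasoning
  ...   | no q+1≢r =
    composition-rowBlocks f (suc q) r (≤-trans len≤ (≤-reflexive (+-suc q f))) (≤∧≢⇒< q<r q+1≢r)

  des-canonical : DesIs Tₐ a
  des-canonical with des-from-placement Tₐ (rowBlocks 0 (length a)) (sym segments-canonical)
                       (trans (cong (map (minRow Tₐ)) segments-canonical) (minRow-rowBlocks (length a) 0))
                       (rowBlocks-increasing (length a) 0)
  ... | d , des≡ , d≗ = d , des≡ , λ where
    (suc r) _ → trans (d≗ (suc r)) (composition-rowBlocks (length a) 0 (suc r) ≤-refl (s≤s z≤n))

desIs-unique : ∀ {a T} → SKT a T → DesIs T a → T ≡ canonicalTableau a
desIs-unique {a} {T} skt (d , des≡ , d≈a) = rowOf-ext T (canonicalTableau a) length≡ λ r →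
  trans (rowOf≡descBlock skt des≡ d≈a r) (sym (rowOf-stackRows 0 a r))
  where
    length≡ : length T ≡ length (canonicalTableau a)
    length≡ = begin
      length T                                  ≡⟨ sym (length-map length T) ⟩
      length (map length T)                     ≡⟨ cong length (SKT.shape skt) ⟩
      length a                                  ≡⟨ cong length (sym (map-length-stackRows 0 a)) ⟩
      length (map length (canonicalTableau a))  ≡⟨ length-map length (canonicalTableau a) ⟩
      length (canonicalTableau a)               ∎
      where open ≡-Reasoning

lemma4p12 : (a : List ℕ) →
    (∃[ Tₐ ] (SKT a Tₐ × DesIs Tₐ a × (∀ T → SKT a T → DesIs T a → T ≡ Tₐ)))
    × (∀ T → SKT a T → ∀ d → des T ≡ just d → d ⊵ part a)
lemma4p12 a =
  (canonicalTableau a , canonical-SKT a , Canonical.des-canonical a , λ T skt desIs → desIs-unique skt desIs) ,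
  (λ T skt d des≡ → dominates skt des≡)
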